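{- Let $k$ and $r$ be positive integers with $k\geq 2$ and $1\leq r<k-1$, let $D$ be the diameter of $K(2k+r,k)$, and let $p\geq 1$ be an integer with $2p+1<D$. Let $A$ and $B$ be vertices of $K_{=2p+1}(2k+r,k)$ and let $\ell\geq 0$ be an integer. If there is a path of length $2\ell$ from $A$ to $B$ in $K_{=2p+1}(2k+r,k)$, then $|A\cap B|\geq k-2\ell rp-r\ell$. If there is a path of length $2\ell+1$ from $A$ to $B$ in $K_{=2p+1}(2k+r,k)$, then $|A\cap B|\leq (2\ell+1)rp+r\ell$.
   Context: For positive integers $n,k$, $[n]^k$ is the set of $k$-element subsets of $\{1,\dots,n\}$. The Kneser graph $K(2k+r,k)$ has vertex set $[2k+r]^k$, with $A,B$ adjacent iff $A\cap B=\emptyset$; it is connected. For a connected graph $G$ and positive integer $d$, the exact distance-$d$ graph $G_{=d}$ has the same vertex set as $G$, with two vertices adjacent iff their distance in $G$ is exactly $d$. $K_{=d}(2k+r,k)$ denotes the exact distance-$d$ graph of $K(2k+r,k)$. (The diameter of $K(2k+r,k)$ is $\lceil (k-1)/r\rceil+1$.) -}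

module Defs where

open import Data.Nat using (ℕ; zero; suc; _+_; _*_; _∸_; _≤_; _<_)
open import Data.Fin.Subset using (Subset; _∩_; ∣_∣; ⊥)
open import Data.Product using (Σ; _×_; ∃; ∃-syntax; proj₁)
open import Relation.Binary.PropositionalEquality using (_≡_)
open import Relation.Nullary using (¬_)

Vertex : ℕ → ℕ → Set
Vertex n k = Σ (Subset n) (λ A → ∣ A ∣ ≡ k)

inter : ∀ {n k} → Vertex n k → Vertex n k → ℕ
inter A B = ∣ proj₁ A ∩ proj₁ B ∣

KAdj : ∀ n k → Vertex n k → Vertex n k → Set
KAdj n k A B = proj₁ A ∩ proj₁ B ≡ ⊥

-- Walks of length m (number of edges) in the graph given by adjacency relation R
-- ("path" in the paper; vertices may repeat).
data Walk {V : Set} (R : V → V → Set) : V → V → ℕ → Set where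
  here : ∀ {x} → Walk R x x zero
  step : ∀ {x y z m} → R x y → Walk R y z m → Walk R x z (suc m)

KDist : ∀ n k → Vertex n k → Vertex n k → ℕ → Set
KDist n k A B d = Walk (KAdj n k) A B d × (∀ m → m < d → ¬ Walk (KAdj n k) A B m)

IsDiameter : ∀ n k → ℕ → Set
IsDiameter n k D =
  (∃[ A ] ∃[ B ] KDist n k A B D) × (∀ A B d → KDist n k A B d → d ≤ D)

ExactAdj : ∀ n k → ℕ → Vertex n k → Vertex n k → Set
ExactAdj n k d A B = KDist n k A B d

{-# OPTIONS --safe #-}
module Submission where

open import Defs
open import Data.Nat using (ℕ; zero; suc; _+_; _*_; _∸_; _≤_; _<_; _≥_)
open import Data.Nat.Properties
open import Data.Nat.Tactic.RingSolver using (solve-∀)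
open import Data.Product using (_×_; _,_; proj₁; proj₂)
open import Data.Vec using ([]; _∷_)
open import Data.Vec.Properties using (∷-injectiveʳ)
open import Data.Fin.Subset using (Subset; inside; outside; _∩_; _∪_; ∁; ∣_∣; ⊤; ⊥)
open import Data.Fin.Subset.Properties using (∩-idem; ∩-identityʳ; ∣⊤∣≡n; ∣p∩q∣≤∣p∣)
open import Relation.Binary.PropositionalEquality

-- If X and Y are disjoint k-subsets of a (2k+r)-set, they leave out only r points, so every
-- k-set B meets X and Y in between k − r and k points altogether. Along a walk in K(2k+r,k)
-- the size of the intersection with a fixed B therefore alternates between large and small:
-- after 2j steps it is at least k − jr, after 2j+1 steps at most jr. A walk of length m in the
-- exact distance-(2p+1) graph unfolds to a walk of length m(2p+1) in K(2k+r,k).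

disjoint⇒∣p∩r∣+∣q∩r∣+∣∁[p∪q]∩r∣≡∣r∣ : ∀ {n} (p q r : Subset n) → p ∩ q ≡ ⊥ →
  ∣ p ∩ r ∣ + ∣ q ∩ r ∣ + ∣ ∁ (p ∪ q) ∩ r ∣ ≡ ∣ r ∣
disjoint⇒∣p∩r∣+∣q∩r∣+∣∁[p∪q]∩r∣≡∣r∣ [] [] [] _ = refl
disjoint⇒∣p∩r∣+∣q∩r∣+∣∁[p∪q]∩r∣≡∣r∣ (inside ∷ p) (inside ∷ q) _ ()
disjoint⇒∣p∩r∣+∣q∩r∣+∣∁[p∪q]∩r∣≡∣r∣ (inside ∷ p) (outside ∷ q) (inside ∷ r) disj =
  cong suc (disjoint⇒∣p∩r∣+∣q∩r∣+∣∁[p∪q]∩r∣≡∣r∣ p q r (∷-injectiveʳ disj))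
disjoint⇒∣p∩r∣+∣q∩r∣+∣∁[p∪q]∩r∣≡∣r∣ (outside ∷ p) (inside ∷ q) (inside ∷ r) disj =
  trans (cong (_+ ∣ ∁ (p ∪ q) ∩ r ∣) (+-suc ∣ p ∩ r ∣ ∣ q ∩ r ∣))
        (cong suc (disjoint⇒∣p∩r∣+∣q∩r∣+∣∁[p∪q]∩r∣≡∣r∣ p q r (∷-injectiveʳ disj)))
disjoint⇒∣p∩r∣+∣q∩r∣+∣∁[p∪q]∩r∣≡∣r∣ (outside ∷ p) (outside ∷ q) (inside ∷ r) disj =
  trans (+-suc (∣ p ∩ r ∣ + ∣ q ∩ r ∣) ∣ ∁ (p ∪ q) ∩ r ∣)
        (cong suc (disjoint⇒∣p∩r∣+∣q∩r∣+∣∁[p∪q]∩r∣≡∣r∣ p q r (∷-injectiveʳ disj)))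
disjoint⇒∣p∩r∣+∣q∩r∣+∣∁[p∪q]∩r∣≡∣r∣ (inside ∷ p) (outside ∷ q) (outside ∷ r) disj =
  disjoint⇒∣p∩r∣+∣q∩r∣+∣∁[p∪q]∩r∣≡∣r∣ p q r (∷-injectiveʳ disj)
disjoint⇒∣p∩r∣+∣q∩r∣+∣∁[p∪q]∩r∣≡∣r∣ (outside ∷ p) (inside ∷ q) (outside ∷ r) disj =
  disjoint⇒∣p∩r∣+∣q∩r∣+∣∁[p∪q]∩r∣≡∣r∣ p q r (∷-injectiveʳ disj)
disjoint⇒∣p∩r∣+∣q∩r∣+∣∁[p∪q]∩r∣≡∣r∣ (outside ∷ p) (outside ∷ q) (outside ∷ r) disj =
  disjoint⇒∣p∩r∣+∣q∩r∣+∣∁[p∪q]∩r∣≡∣r∣ p q r (∷-injectiveʳ disj)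

disjoint⇒∣p∣+∣q∣+∣∁[p∪q]∣≡n : ∀ {n} (p q : Subset n) → p ∩ q ≡ ⊥ →
  ∣ p ∣ + ∣ q ∣ + ∣ ∁ (p ∪ q) ∣ ≡ n
disjoint⇒∣p∣+∣q∣+∣∁[p∪q]∣≡n {n} p q disj
  with disjoint⇒∣p∩r∣+∣q∩r∣+∣∁[p∪q]∩r∣≡∣r∣ p q ⊤ disj
... | partition-of-⊤
  rewrite ∩-identityʳ p | ∩-identityʳ q | ∩-identityʳ (∁ (p ∪ q)) | ∣⊤∣≡n n = partition-of-⊤

module _ {V : Set} where

  _◅◅_ : ∀ {R : V → V → Set} {x y z a b} → Walk R x y a → Walk R y z b → Walk R x z (a + b)
  here ◅◅ w = w
  step e v ◅◅ w = step e (v ◅◅ w)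

  Walk-concatMap : ∀ {R S : V → V → Set} {d} → (∀ {x y} → R x y → Walk S x y d) →
    ∀ {x y m} → Walk R x y m → Walk S x y (m * d)
  Walk-concatMap f here = here
  Walk-concatMap f (step e w) = f e ◅◅ Walk-concatMap f w

module _ {k r : ℕ} where

  private
    n : ℕ
    n = 2 * k + r

  adjacent⇒k∸r≤inter+inter≤k : ∀ (X Y B : Vertex n k) → KAdj n k X Y →
    (k ∸ r ≤ inter X B + inter Y B) × (inter X B + inter Y B ≤ k)
  adjacent⇒k∸r≤inter+inter≤k (x , ∣x∣≡k) (y , ∣y∣≡k) (b , ∣b∣≡k) disj =
    m≤n+o⇒m∸n≤o k r k≤r+sum , subst (sum ≤_) sum+outside-b≡k (m≤m+n sum outside-b)
    where
    sum outside-b : ℕ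
    sum = ∣ x ∩ b ∣ + ∣ y ∩ b ∣
    outside-b = ∣ ∁ (x ∪ y) ∩ b ∣

    ∣∁[x∪y]∣≡r : ∣ ∁ (x ∪ y) ∣ ≡ r
    ∣∁[x∪y]∣≡r = +-cancelˡ-≡ (k + k) _ _ (begin
      k + k + ∣ ∁ (x ∪ y) ∣          ≡⟨ cong₂ (λ u v → u + v + ∣ ∁ (x ∪ y) ∣) (sym ∣x∣≡k) (sym ∣y∣≡k) ⟩
      ∣ x ∣ + ∣ y ∣ + ∣ ∁ (x ∪ y) ∣  ≡⟨ disjoint⇒∣p∣+∣q∣+∣∁[p∪q]∣≡n x y disj ⟩
      2 * k + r                      ≡⟨ cong (λ u → k + u + r) (+-identityʳ k) ⟩
      k + k + r                      ∎)
      where open ≡-Reasoning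

    sum+outside-b≡k : sum + outside-b ≡ k
    sum+outside-b≡k = trans (disjoint⇒∣p∩r∣+∣q∩r∣+∣∁[p∪q]∩r∣≡∣r∣ x y b disj) ∣b∣≡k

    k≤r+sum : k ≤ r + sum
    k≤r+sum = begin
      k                ≡⟨ sym sum+outside-b≡k ⟩
      sum + outside-b  ≤⟨ +-monoʳ-≤ sum (≤-trans (∣p∩q∣≤∣p∣ (∁ (x ∪ y)) b) (≤-reflexive ∣∁[x∪y]∣≡r)) ⟩
      sum + r          ≡⟨ +-comm sum r ⟩
      r + sum          ∎
      where open ≤-Reasoning

  evenWalk⇒k∸jr≤inter : ∀ j {X B : Vertex n k} → Walk (KAdj n k) X B (2 * j) → k ∸ j * r ≤ inter X B
  oddWalk⇒inter≤jr : ∀ j {X B : Vertex n k} → Walk (KAdj n k) X B (suc (2 * j)) → inter X B ≤ j * r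

  evenWalk⇒k∸jr≤inter zero {b , ∣b∣≡k} here = ≤-reflexive (sym (trans (cong ∣_∣ (∩-idem b)) ∣b∣≡k))
  evenWalk⇒k∸jr≤inter (suc j) {X} {B} w with subst (Walk (KAdj n k) X B) (*-suc 2 j) w
  ... | step {y = Y} X-Y w′ = begin
    k ∸ (r + j * r)        ≡⟨ sym (∸-+-assoc k r (j * r)) ⟩
    k ∸ r ∸ j * r          ≤⟨ m≤n+o⇒m∸n≤o (k ∸ r) (j * r) k∸r≤jr+inter ⟩
    inter X B              ∎
    where
    open ≤-Reasoning
    k∸r≤jr+inter : k ∸ r ≤ j * r + inter X B
    k∸r≤jr+inter = begin
      k ∸ r                  ≤⟨ proj₁ (adjacent⇒k∸r≤inter+inter≤k X Y B X-Y) ⟩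
      inter X B + inter Y B  ≤⟨ +-monoʳ-≤ (inter X B) (oddWalk⇒inter≤jr j w′) ⟩
      inter X B + j * r      ≡⟨ +-comm (inter X B) (j * r) ⟩
      j * r + inter X B      ∎

  oddWalk⇒inter≤jr j {X} {B} (step {y = Y} X-Y w) = +-cancelʳ-≤ (k ∸ j * r) (inter X B) (j * r) (begin
    inter X B + (k ∸ j * r)  ≤⟨ +-monoʳ-≤ (inter X B) (evenWalk⇒k∸jr≤inter j w) ⟩
    inter X B + inter Y B    ≤⟨ proj₂ (adjacent⇒k∸r≤inter+inter≤k X Y B X-Y) ⟩
    k                        ≤⟨ m≤n+m∸n k (j * r) ⟩
    j * r + (k ∸ j * r)      ∎)
    where open ≤-Reasoning

mainTheorem15 : (k r : ℕ) → k ≥ 2 → 1 ≤ r → r + 1 < k →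
    (D : ℕ) → IsDiameter (2 * k + r) k D →
    (p : ℕ) → p ≥ 1 → 2 * p + 1 < D →
    (A B : Vertex (2 * k + r) k) → (ℓ : ℕ) →
    (Walk (ExactAdj (2 * k + r) k (2 * p + 1)) A B (2 * ℓ) →
      inter A B ≥ k ∸ (2 * ℓ * r * p) ∸ (r * ℓ))
    × (Walk (ExactAdj (2 * k + r) k (2 * p + 1)) A B (2 * ℓ + 1) →
      inter A B ≤ (2 * ℓ + 1) * r * p + r * ℓ)
mainTheorem15 k r _ _ _ _ _ p _ _ A B ℓ = even , odd
  where
  unfold : ∀ {m} → Walk (ExactAdj (2 * k + r) k (2 * p + 1)) A B m →
    Walk (KAdj (2 * k + r) k) A B (m * (2 * p + 1))
  unfold = Walk-concatMap proj₁

  even-length : ∀ ℓ p → 2 * ℓ * (2 * p + 1) ≡ 2 * (ℓ * (2 * p + 1))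
  even-length = solve-∀
  odd-length : ∀ ℓ p → (2 * ℓ + 1) * (2 * p + 1) ≡ suc (2 * (2 * ℓ * p + ℓ + p))
  odd-length = solve-∀
  even-bound : ∀ ℓ p r → 2 * ℓ * r * p + r * ℓ ≡ ℓ * (2 * p + 1) * r
  even-bound = solve-∀
  odd-bound : ∀ ℓ p r → (2 * ℓ * p + ℓ + p) * r ≡ (2 * ℓ + 1) * r * p + r * ℓ
  odd-bound = solve-∀

  even : Walk (ExactAdj (2 * k + r) k (2 * p + 1)) A B (2 * ℓ) →
    inter A B ≥ k ∸ (2 * ℓ * r * p) ∸ (r * ℓ)
  even w = subst (_≤ inter A B)
    (sym (trans (∸-+-assoc k (2 * ℓ * r * p) (r * ℓ)) (cong (k ∸_) (even-bound ℓ p r))))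
    (evenWalk⇒k∸jr≤inter (ℓ * (2 * p + 1)) (subst (Walk _ A B) (even-length ℓ p) (unfold w)))

  odd : Walk (ExactAdj (2 * k + r) k (2 * p + 1)) A B (2 * ℓ + 1) →
    inter A B ≤ (2 * ℓ + 1) * r * p + r * ℓ
  odd w = subst (inter A B ≤_) (odd-bound ℓ p r)
    (oddWalk⇒inter≤jr (2 * ℓ * p + ℓ + p) (subst (Walk _ A B) (odd-length ℓ p) (unfold w)))
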